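{- For every positive integer $b$, every element of $Q_{1,b}^2$ can be written as a sum of at most three squares of elements of $Q_{1,b}$. Consequently $g_{1,b}(2)=3$ for all positive integers $b$.
   Context: For positive integers $a,b$, let $Q_{a,b}=\{\alpha_0+\alpha_1\mathbf{i}+\alpha_2\mathbf{j}+\alpha_3\mathbf{k} : \alpha_0,\alpha_1,\alpha_2,\alpha_3\in\mathbb{Z}\}$ be the quaternion ring with $\mathbf{i}^2=-a$, $\mathbf{j}^2=-b$, $\mathbf{i}\mathbf{j}=-\mathbf{j}\mathbf{i}=\mathbf{k}$ (so $\mathbf{k}^2=-ab$). Let $Q_{a,b}^2$ denote the additive group generated by all squares $x^2$, $x\in Q_{a,b}$. $g_{a,b}(2)$ denotes the least positive integer $g$ such that every element of $Q_{a,b}^2$ can be written as a sum of at most $g$ squares of elements of $Q_{a,b}$. -}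

module Defs where

open import Data.Nat using (ℕ; _≤_)
open import Data.Integer using (ℤ; +_; _+_; _-_; _*_; -_)
open import Data.List using (List; []; _∷_; length; foldr)
open import Data.Product using (Σ; _×_; ∃-syntax)
open import Relation.Binary.PropositionalEquality using (_≡_)

-- An element α₀ + α₁ i + α₂ j + α₃ k of Q_{a,b} (integer coefficients).
record Quat : Set where
  constructor quat
  field
    c0 c1 c2 c3 : ℤ

open Quat public

-- Multiplication in Q_{a,b}: i² = -a, j² = -b, ij = -ji = k.
qmul : ℕ → ℕ → Quat → Quat → Quat
qmul a b (quat x0 x1 x2 x3) (quat y0 y1 y2 y3) = quat
  (x0 * y0 - (+ a) * (x1 * y1) - (+ b) * (x2 * y2) - (+ a) * (+ b) * (x3 * y3))
  (x0 * y1 + x1 * y0 + (+ b) * (x2 * y3 - x3 * y2))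
  (x0 * y2 + x2 * y0 + (+ a) * (x3 * y1 - x1 * y3))
  (x0 * y3 + x3 * y0 + x1 * y2 - x2 * y1)

qadd : Quat → Quat → Quat
qadd (quat x0 x1 x2 x3) (quat y0 y1 y2 y3) =
  quat (x0 + y0) (x1 + y1) (x2 + y2) (x3 + y3)

qneg : Quat → Quat
qneg (quat x0 x1 x2 x3) = quat (- x0) (- x1) (- x2) (- x3)

qzero : Quat
qzero = quat (+ 0) (+ 0) (+ 0) (+ 0)

qsq : ℕ → ℕ → Quat → Quat
qsq a b x = qmul a b x x

data InQ² (a b : ℕ) : Quat → Set where
  sq   : (x : Quat) → InQ² a b (qsq a b x)
  zer  : InQ² a b qzero
  neg  : ∀ {y} → InQ² a b y → InQ² a b (qneg y)
  plus : ∀ {y z} → InQ² a b y → InQ² a b z → InQ² a b (qadd y z)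

sumSq : ℕ → ℕ → List Quat → Quat
sumSq a b = foldr (λ x acc → qadd (qsq a b x) acc) qzero

SumOfAtMostSquares : ℕ → ℕ → ℕ → Quat → Set
SumOfAtMostSquares a b g y = ∃[ xs ] (length xs ≤ g × sumSq a b xs ≡ y)

Bound : ℕ → ℕ → ℕ → Set
Bound a b g = ∀ y → InQ² a b y → SumOfAtMostSquares a b g y

IsG2 : ℕ → ℕ → ℕ → Set
IsG2 a b g = 1 ≤ g × Bound a b g × (∀ h → 1 ≤ h → Bound a b h → g ≤ h)

{-# OPTIONS --safe #-}
module Submission where

-- Squaring in Q_{1,b} gives (x0² − x1² − b x2² − b x3²) + 2 x0 (x1 i + x2 j + x3 k), so every
-- element of Q_{1,b}^2 is n + 2(u i + v j + w k). Subtracting (1 + u i + v j + w k)² leaves an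
-- integer m. Odd m is (t + 1)² + (t i)²; for even m one subtracts (1 + (u − 1) i + v j + w k)²
-- instead, and the odd remainder plus 2i is (p + i)² + (1 + (1 − p) i)².
--
-- Two squares do not suffice for 2 + 2i = (1 + i)² + 1² + 1². If x² + y² = 2 + 2i, the vectors
-- Xₖ = (xₖ, yₖ) ∈ ℤ² satisfy ⟨X₀, X₁⟩ = 1 and X₂, X₃ ⊥ X₀, so |X₂|² and |X₃|² are multiples of
-- |X₀|². The real part then forces |X₀|² − |X₁|² = 2, and Brahmagupta's identity
-- |X₀|² |X₁|² = 1 + det(X₀, X₁)² turns this into (|X₁|² + 1)² = det(X₀, X₁)² + 2, which is
-- impossible modulo 4.

open import Defs
open import Data.Nat as ℕ using (ℕ; zero; suc; _≤_; z≤n; s≤s)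
import Data.Nat.Properties as ℕ
open import Data.Nat.DivMod using (_%_; m%n<n; %-distribˡ-+; %-distribˡ-*)
open import Data.Integer as ℤ using (ℤ; +_; +[1+_]; -[1+_]; 0ℤ; 1ℤ; _+_; _-_; _*_; -_; ∣_∣)
open import Data.Integer.DivMod using (_/ℕ_; _%ℕ_; n%ℕd<d; a≡a%ℕn+[a/ℕn]*n)
import Data.Integer.Properties as ℤ
open import Data.Integer.Tactic.RingSolver using (solve-∀)
open import Data.List using ([]; _∷_)
open import Data.Product using (_×_; _,_; ∃-syntax)
open import Data.Sum using (_⊎_; inj₁; inj₂)
open import Data.Empty using (⊥-elim)
open import Relation.Nullary using (¬_; yes; no)
open import Relation.Binary.PropositionalEquality
open ≡-Reasoning

square-mod-4 : ∀ n → n ℕ.* n % 4 ≡ 0 ⊎ n ℕ.* n % 4 ≡ 1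
square-mod-4 n =
  subst (λ r → r ≡ 0 ⊎ r ≡ 1) (sym (%-distribˡ-* n n 4)) (residue (n % 4) (m%n<n n 4))
  where
  residue : ∀ r → r ℕ.< 4 → r ℕ.* r % 4 ≡ 0 ⊎ r ℕ.* r % 4 ≡ 1
  residue 0 _ = inj₁ refl
  residue 1 _ = inj₂ refl
  residue 2 _ = inj₁ refl
  residue 3 _ = inj₂ refl
  residue (suc (suc (suc (suc _)))) (s≤s (s≤s (s≤s (s≤s ()))))

m*m≢n*n+2 : ∀ m n → m ℕ.* m ≢ n ℕ.* n ℕ.+ 2
m*m≢n*n+2 m n eq = residues-differ (square-mod-4 m) (square-mod-4 n) (begin
  m ℕ.* m % 4                ≡⟨ cong (_% 4) eq ⟩
  (n ℕ.* n ℕ.+ 2) % 4        ≡⟨ %-distribˡ-+ (n ℕ.* n) 2 4 ⟩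
  (n ℕ.* n % 4 ℕ.+ 2) % 4    ∎)
  where
  residues-differ : ∀ {r s} → r ≡ 0 ⊎ r ≡ 1 → s ≡ 0 ⊎ s ≡ 1 → r ≢ (s ℕ.+ 2) % 4
  residues-differ (inj₁ refl) (inj₁ refl) ()
  residues-differ (inj₁ refl) (inj₂ refl) ()
  residues-differ (inj₂ refl) (inj₁ refl) ()
  residues-differ (inj₂ refl) (inj₂ refl) ()

i*i≡+∣i∣*∣i∣ : ∀ i → i * i ≡ + (∣ i ∣ ℕ.* ∣ i ∣)
i*i≡+∣i∣*∣i∣ (+ zero)  = refl
i*i≡+∣i∣*∣i∣ +[1+ n ] = refl
i*i≡+∣i∣*∣i∣ -[1+ n ] = refl

i*i+j*j≡+∣i∣*∣i∣+∣j∣*∣j∣ : ∀ i j → i * i + j * j ≡ + (∣ i ∣ ℕ.* ∣ i ∣ ℕ.+ ∣ j ∣ ℕ.* ∣ j ∣)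
i*i+j*j≡+∣i∣*∣i∣+∣j∣*∣j∣ i j = cong₂ _+_ (i*i≡+∣i∣*∣i∣ i) (i*i≡+∣i∣*∣i∣ j)

i*i≢j*j+2 : ∀ i j → i * i ≢ j * j + + 2
i*i≢j*j+2 i j eq = m*m≢n*n+2 ∣ i ∣ ∣ j ∣ (ℤ.+-injective (begin
  + (∣ i ∣ ℕ.* ∣ i ∣)  ≡⟨ sym (i*i≡+∣i∣*∣i∣ i) ⟩
  i * i                ≡⟨ eq ⟩
  j * j + + 2          ≡⟨ cong (_+ + 2) (i*i≡+∣i∣*∣i∣ j) ⟩
  + (∣ j ∣ ℕ.* ∣ j ∣ ℕ.+ 2) ∎))

even-or-odd : ∀ m → ∃[ t ] (m ≡ + 2 * t ⊎ m ≡ + 2 * t + 1ℤ)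
even-or-odd m = m /ℕ 2 , split (m %ℕ 2) (n%ℕd<d m 2) (a≡a%ℕn+[a/ℕn]*n m 2)
  where
  split : ∀ r → r ℕ.< 2 → m ≡ + r + m /ℕ 2 * + 2 → m ≡ + 2 * (m /ℕ 2) ⊎ m ≡ + 2 * (m /ℕ 2) + 1ℤ
  split 0 _ eq = inj₁ (trans eq (trans (ℤ.+-identityˡ (m /ℕ 2 * + 2)) (ℤ.*-comm (m /ℕ 2) (+ 2))))
  split 1 _ eq = inj₂ (trans eq (trans (ℤ.+-comm 1ℤ (m /ℕ 2 * + 2)) (cong (_+ 1ℤ) (ℤ.*-comm (m /ℕ 2) (+ 2)))))
  split (suc (suc _)) (s≤s (s≤s ()))

quat-cong : ∀ {x0 x1 x2 x3 y0 y1 y2 y3} →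
            x0 ≡ y0 → x1 ≡ y1 → x2 ≡ y2 → x3 ≡ y3 → quat x0 x1 x2 x3 ≡ quat y0 y1 y2 y3
quat-cong refl refl refl refl = refl

qadd-identityʳ : ∀ x → qadd x qzero ≡ x
qadd-identityʳ (quat x0 x1 x2 x3) =
  quat-cong (ℤ.+-identityʳ x0) (ℤ.+-identityʳ x1) (ℤ.+-identityʳ x2) (ℤ.+-identityʳ x3)

sumSq-pair : ∀ a b x y → sumSq a b (x ∷ y ∷ []) ≡ qadd (qsq a b x) (qsq a b y)
sumSq-pair a b x y = cong (qadd (qsq a b x)) (qadd-identityʳ (qsq a b y))

-- The pure part squares to a scalar, so the only cross terms are 2 x0 (x1 i + x2 j + x3 k).
qsqExpanded : ℕ → ℕ → Quat → Quat
qsqExpanded a b (quat x0 x1 x2 x3) =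
  quat (x0 * x0 - + a * (x1 * x1) - + b * (x2 * x2) - + a * + b * (x3 * x3))
       (+ 2 * (x0 * x1)) (+ 2 * (x0 * x2)) (+ 2 * (x0 * x3))

qsq≡qsqExpanded : ∀ a b x → qsq a b x ≡ qsqExpanded a b x
qsq≡qsqExpanded a b (quat x0 x1 x2 x3) =
  quat-cong refl (cross (+ b) x0 x1 x2 x3) (cross (+ a) x0 x2 x3 x1) (cross′ x0 x3 x1 x2)
  where
  cross : ∀ c x y z w → x * y + y * x + c * (z * w - w * z) ≡ + 2 * (x * y)
  cross = solve-∀
  cross′ : ∀ x y z w → x * y + y * x + z * w - w * z ≡ + 2 * (x * y)
  cross′ = solve-∀

qsq-gaussian : ∀ a b x0 x1 →
  qsq a b (quat x0 x1 0ℤ 0ℤ) ≡ quat (x0 * x0 - + a * (x1 * x1)) (+ 2 * (x0 * x1)) 0ℤ 0ℤ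
qsq-gaussian a b x0 x1 = trans (qsq≡qsqExpanded a b (quat x0 x1 0ℤ 0ℤ))
  (quat-cong (drop-jk (+ a) (+ b) x0 x1) refl (vanish x0) (vanish x0))
  where
  drop-jk : ∀ A B x y → x * x - A * (y * y) - B * (0ℤ * 0ℤ) - A * B * (0ℤ * 0ℤ) ≡ x * x - A * (y * y)
  drop-jk = solve-∀
  vanish : ∀ x → + 2 * (x * 0ℤ) ≡ 0ℤ
  vanish x = cong (+ 2 *_) (ℤ.*-zeroʳ x)

qsq-zero : ∀ a b → qsq a b qzero ≡ qzero
qsq-zero a b = trans (qsq-gaussian a b 0ℤ 0ℤ)
  (cong (λ z → quat (0ℤ - z) 0ℤ 0ℤ 0ℤ) (ℤ.*-zeroʳ (+ a)))

pureNorm : ℕ → ℕ → ℤ → ℤ → ℤ → ℤ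
pureNorm a b u v w = + a * (u * u) + + b * (v * v) + + a * + b * (w * w)

qsq-one-plus-pure : ∀ a b u v w →
  qsq a b (quat 1ℤ u v w) ≡ quat (1ℤ - pureNorm a b u v w) (+ 2 * u) (+ 2 * v) (+ 2 * w)
qsq-one-plus-pure a b u v w = trans (qsq≡qsqExpanded a b (quat 1ℤ u v w))
  (quat-cong (regroup (+ a) (+ b) u v w) (unit u) (unit v) (unit w))
  where
  regroup : ∀ A B u v w →
    1ℤ * 1ℤ - A * (u * u) - B * (v * v) - A * B * (w * w) ≡ 1ℤ - (A * (u * u) + B * (v * v) + A * B * (w * w))
  regroup = solve-∀
  unit : ∀ x → + 2 * (1ℤ * x) ≡ + 2 * x
  unit x = cong (+ 2 *_) (ℤ.*-identityˡ x)

data EvenPure : Quat → Set where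
  evenPure : ∀ n u v w → EvenPure (quat n (+ 2 * u) (+ 2 * v) (+ 2 * w))

InQ²⇒EvenPure : ∀ {a b y} → InQ² a b y → EvenPure y
InQ²⇒EvenPure {a} {b} (sq (quat x0 x1 x2 x3)) =
  subst EvenPure (sym (qsq≡qsqExpanded a b (quat x0 x1 x2 x3))) (evenPure _ _ _ _)
InQ²⇒EvenPure zer = evenPure 0ℤ 0ℤ 0ℤ 0ℤ
InQ²⇒EvenPure (neg p) with InQ²⇒EvenPure p
... | evenPure n u v w = subst EvenPure (quat-cong refl (negate u) (negate v) (negate w))
                           (evenPure (- n) (- u) (- v) (- w))
  where
  negate : ∀ x → + 2 * - x ≡ - (+ 2 * x)
  negate x = sym (ℤ.neg-distribʳ-* (+ 2) x)
InQ²⇒EvenPure (plus p q) with InQ²⇒EvenPure p | InQ²⇒EvenPure q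
... | evenPure n u v w | evenPure n′ u′ v′ w′ =
  subst EvenPure
    (quat-cong refl (ℤ.*-distribˡ-+ (+ 2) u u′) (ℤ.*-distribˡ-+ (+ 2) v v′) (ℤ.*-distribˡ-+ (+ 2) w w′))
    (evenPure (n + n′) (u + u′) (v + v′) (w + w′))

odd-sum-of-two-squares : ∀ b t →
  qadd (qsq 1 b (quat (t + 1ℤ) 0ℤ 0ℤ 0ℤ)) (qsq 1 b (quat 0ℤ t 0ℤ 0ℤ)) ≡ quat (+ 2 * t + 1ℤ) 0ℤ 0ℤ 0ℤ
odd-sum-of-two-squares b t =
  trans (cong₂ qadd (qsq-gaussian 1 b (t + 1ℤ) 0ℤ) (qsq-gaussian 1 b 0ℤ t))
        (quat-cong (real t) (pure t) refl refl)
  where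
  real : ∀ t → (t + 1ℤ) * (t + 1ℤ) - 1ℤ * (0ℤ * 0ℤ) + (0ℤ * 0ℤ - 1ℤ * (t * t)) ≡ + 2 * t + 1ℤ
  real = solve-∀
  pure : ∀ t → + 2 * ((t + 1ℤ) * 0ℤ) + + 2 * (0ℤ * t) ≡ 0ℤ
  pure = solve-∀

odd+2i-sum-of-two-squares : ∀ b p →
  qadd (qsq 1 b (quat p 1ℤ 0ℤ 0ℤ)) (qsq 1 b (quat 1ℤ (1ℤ - p) 0ℤ 0ℤ)) ≡ quat (+ 2 * p - 1ℤ) (+ 2) 0ℤ 0ℤ
odd+2i-sum-of-two-squares b p =
  trans (cong₂ qadd (qsq-gaussian 1 b p 1ℤ) (qsq-gaussian 1 b 1ℤ (1ℤ - p)))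
        (quat-cong (real p) (pure p) refl refl)
  where
  real : ∀ p → p * p - 1ℤ * (1ℤ * 1ℤ) + (1ℤ * 1ℤ - 1ℤ * ((1ℤ - p) * (1ℤ - p))) ≡ + 2 * p - 1ℤ
  real = solve-∀
  pure : ∀ p → + 2 * (p * 1ℤ) + + 2 * (1ℤ * (1ℤ - p)) ≡ + 2
  pure = solve-∀

-- m is the integer left after subtracting (1 + u i + v j + w k)².
sum-of-three-squares : ∀ b m u v w →
  SumOfAtMostSquares 1 b 3 (quat (1ℤ - pureNorm 1 b u v w + m) (+ 2 * u) (+ 2 * v) (+ 2 * w))
sum-of-three-squares b m u v w with even-or-odd m
... | t , inj₂ refl = s ∷ g ∷ h ∷ [] , ℕ.≤-refl ,
  trans (cong (qadd (qsq 1 b s)) (sumSq-pair 1 b g h))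
  (trans (cong₂ qadd (qsq-one-plus-pure 1 b u v w) (odd-sum-of-two-squares b t))
         (quat-cong refl (ℤ.+-identityʳ _) (ℤ.+-identityʳ _) (ℤ.+-identityʳ _)))
  where
  s = quat 1ℤ u v w
  g = quat (t + 1ℤ) 0ℤ 0ℤ 0ℤ
  h = quat 0ℤ t 0ℤ 0ℤ
... | t , inj₁ refl = s ∷ g ∷ h ∷ [] , ℕ.≤-refl ,
  trans (cong (qadd (qsq 1 b s)) (sumSq-pair 1 b g h))
  (trans (cong₂ qadd (qsq-one-plus-pure 1 b (u - 1ℤ) v w) (odd+2i-sum-of-two-squares b p))
         (quat-cong (real (+ b) u v w t) (pure u) (ℤ.+-identityʳ _) (ℤ.+-identityʳ _)))
  where
  p = t - u + 1ℤ
  s = quat 1ℤ (u - 1ℤ) v w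
  g = quat p 1ℤ 0ℤ 0ℤ
  h = quat 1ℤ (1ℤ - p) 0ℤ 0ℤ
  real : ∀ B u v w t →
    1ℤ - (1ℤ * ((u - 1ℤ) * (u - 1ℤ)) + B * (v * v) + 1ℤ * B * (w * w)) + (+ 2 * (t - u + 1ℤ) - 1ℤ)
      ≡ 1ℤ - (1ℤ * (u * u) + B * (v * v) + 1ℤ * B * (w * w)) + + 2 * t
  real = solve-∀
  pure : ∀ u → + 2 * (u - 1ℤ) + + 2 ≡ + 2 * u
  pure = solve-∀

bound-three : ∀ b → Bound 1 b 3
bound-three b y y∈Q² with InQ²⇒EvenPure y∈Q²
... | evenPure n u v w =
  subst (λ r → SumOfAtMostSquares 1 b 3 (quat r (+ 2 * u) (+ 2 * v) (+ 2 * w)))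
        (x+[n-x]≡n (1ℤ - pureNorm 1 b u v w) n)
        (sum-of-three-squares b (n - (1ℤ - pureNorm 1 b u v w)) u v w)
  where
  x+[n-x]≡n : ∀ x n → x + (n - x) ≡ n
  x+[n-x]≡n = solve-∀

-- (p, q) = k (y0, − x0): with d = x0 x1 + y0 y1 and e = x0 p + y0 q one has
-- p d = y0 k + x1 e and q d = − x0 k + y1 e.
orthogonal-norm : ∀ x0 y0 x1 y1 p q → x0 * x1 + y0 * y1 ≡ 1ℤ → x0 * p + y0 * q ≡ 0ℤ →
  p * p + q * q ≡ (y1 * p - x1 * q) * (y1 * p - x1 * q) * (x0 * x0 + y0 * y0)
orthogonal-norm x0 y0 x1 y1 p q d≡1 e≡0 = begin
  p * p + q * q                                   ≡⟨ sym (ℤ.*-identityʳ _) ⟩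
  (p * p + q * q) * (1ℤ * 1ℤ)                     ≡⟨ cong (λ d → (p * p + q * q) * (d * d)) (sym d≡1) ⟩
  (p * p + q * q) * (d * d)                       ≡⟨ expand x0 y0 x1 y1 p q ⟩
  k * k * n₀ + e * r                              ≡⟨ cong (λ e′ → k * k * n₀ + e′ * r) e≡0 ⟩
  k * k * n₀ + 0ℤ                                 ≡⟨ ℤ.+-identityʳ _ ⟩
  k * k * n₀                                      ∎
  where
  d = x0 * x1 + y0 * y1
  e = x0 * p + y0 * q
  k = y1 * p - x1 * q
  n₀ = x0 * x0 + y0 * y0
  r = + 2 * k * (x1 * y0 - x0 * y1) + e * (x1 * x1 + y1 * y1)
  expand : ∀ x0 y0 x1 y1 p q →
    (p * p + q * q) * ((x0 * x1 + y0 * y1) * (x0 * x1 + y0 * y1)) ≡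
    (y1 * p - x1 * q) * (y1 * p - x1 * q) * (x0 * x0 + y0 * y0) +
    (x0 * p + y0 * q) * (+ 2 * (y1 * p - x1 * q) * (x1 * y0 - x0 * y1) + (x0 * p + y0 * q) * (x1 * x1 + y1 * y1))
  expand = solve-∀

i-j-k*i≡2⇒i-j≡2 : ∀ {i j k m n o} → i ≡ + m → j ≡ + n → k ≡ + o → i - j - k * i ≡ + 2 → i - j ≡ + 2
i-j-k*i≡2⇒i-j≡2 {o = zero} refl refl refl eq = trans (sym (ℤ.+-identityʳ _)) eq
i-j-k*i≡2⇒i-j≡2 {m = m} {n} {suc o} refl refl refl eq = ⊥-elim (-n≢2 (begin
  - + (n ℕ.+ o ℕ.* m)          ≡⟨ cong -_ (trans (ℤ.pos-+ n (o ℕ.* m)) (cong (_+_ (+ n)) (ℤ.pos-* o m))) ⟩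
  - (+ n + + o * + m)           ≡⟨ sym (regroup (+ m) (+ n) (+ o)) ⟩
  + m - + n - + suc o * + m     ≡⟨ eq ⟩
  + 2                           ∎))
  where
  regroup : ∀ i j k → i - j - (1ℤ + k) * i ≡ - (j + k * i)
  regroup = solve-∀
  -n≢2 : ∀ {l} → - + l ≢ + 2
  -n≢2 {zero} ()
  -n≢2 {suc l} ()

-- By Brahmagupta's identity n₀ n₁ = d² + c², so n₀ = n₁ + 2 would give (n₁ + 1)² = c² + 2.
unimodular-norm-gap≢2 : ∀ x0 y0 x1 y1 → x0 * x1 + y0 * y1 ≡ 1ℤ →
  (x0 * x0 + y0 * y0) - (x1 * x1 + y1 * y1) ≢ + 2
unimodular-norm-gap≢2 x0 y0 x1 y1 d≡1 gap≡2 = i*i≢j*j+2 (n₁ + 1ℤ) c (begin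
  (n₁ + 1ℤ) * (n₁ + 1ℤ)                          ≡⟨ brahmagupta x0 y0 x1 y1 ⟩
  d * d + c * c - (n₀ - n₁ - + 2) * n₁ + 1ℤ      ≡⟨ cong₂ (λ d g → d * d + c * c - (g - + 2) * n₁ + 1ℤ) d≡1 gap≡2 ⟩
  1ℤ * 1ℤ + c * c - (+ 2 - + 2) * n₁ + 1ℤ        ≡⟨ tidy c n₁ ⟩
  c * c + + 2                                    ∎)
  where
  n₀ = x0 * x0 + y0 * y0
  n₁ = x1 * x1 + y1 * y1
  d = x0 * x1 + y0 * y1
  c = x0 * y1 - x1 * y0
  brahmagupta : ∀ x0 y0 x1 y1 →
    (x1 * x1 + y1 * y1 + 1ℤ) * (x1 * x1 + y1 * y1 + 1ℤ) ≡
    (x0 * x1 + y0 * y1) * (x0 * x1 + y0 * y1) + (x0 * y1 - x1 * y0) * (x0 * y1 - x1 * y0)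
      - ((x0 * x0 + y0 * y0) - (x1 * x1 + y1 * y1) - + 2) * (x1 * x1 + y1 * y1) + 1ℤ
  brahmagupta = solve-∀
  tidy : ∀ c n → 1ℤ * 1ℤ + c * c - (+ 2 - + 2) * n + 1ℤ ≡ c * c + + 2
  tidy = solve-∀

two-squares-system-unsolvable : ∀ b x0 x1 x2 x3 y0 y1 y2 y3 →
  x0 * x1 + y0 * y1 ≡ 1ℤ → x0 * x2 + y0 * y2 ≡ 0ℤ → x0 * x3 + y0 * y3 ≡ 0ℤ →
  (x0 * x0 + y0 * y0) - (x1 * x1 + y1 * y1) - + b * ((x2 * x2 + y2 * y2) + (x3 * x3 + y3 * y3)) ≢ + 2
two-squares-system-unsolvable b x0 x1 x2 x3 y0 y1 y2 y3 d≡1 e₂≡0 e₃≡0 real≡2 =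
  unimodular-norm-gap≢2 x0 y0 x1 y1 d≡1
    (i-j-k*i≡2⇒i-j≡2 (i*i+j*j≡+∣i∣*∣i∣+∣j∣*∣j∣ x0 y0) (i*i+j*j≡+∣i∣*∣i∣+∣j∣*∣j∣ x1 y1) b*k≡
      (trans (sym real≡) real≡2))
  where
  n₀ = x0 * x0 + y0 * y0
  n₁ = x1 * x1 + y1 * y1
  k₂ = y1 * x2 - x1 * y2
  k₃ = y1 * x3 - x1 * y3
  b*k≡ : + b * (k₂ * k₂ + k₃ * k₃) ≡ + (b ℕ.* (∣ k₂ ∣ ℕ.* ∣ k₂ ∣ ℕ.+ ∣ k₃ ∣ ℕ.* ∣ k₃ ∣))
  b*k≡ = trans (cong (_*_ (+ b)) (i*i+j*j≡+∣i∣*∣i∣+∣j∣*∣j∣ k₂ k₃)) (sym (ℤ.pos-* b _))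
  factor : ∀ B s t n → B * (s * n + t * n) ≡ B * (s + t) * n
  factor = solve-∀
  real≡ : n₀ - n₁ - + b * ((x2 * x2 + y2 * y2) + (x3 * x3 + y3 * y3)) ≡ n₀ - n₁ - + b * (k₂ * k₂ + k₃ * k₃) * n₀
  real≡ = begin
    n₀ - n₁ - + b * ((x2 * x2 + y2 * y2) + (x3 * x3 + y3 * y3))
      ≡⟨ cong₂ (λ s t → n₀ - n₁ - + b * (s + t))
               (orthogonal-norm x0 y0 x1 y1 x2 y2 d≡1 e₂≡0) (orthogonal-norm x0 y0 x1 y1 x3 y3 d≡1 e₃≡0) ⟩
    n₀ - n₁ - + b * (k₂ * k₂ * n₀ + k₃ * k₃ * n₀)
      ≡⟨ cong (_-_ (n₀ - n₁)) (factor (+ b) (k₂ * k₂) (k₃ * k₃) n₀) ⟩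
    n₀ - n₁ - + b * (k₂ * k₂ + k₃ * k₃) * n₀ ∎

twoPlusTwoI : Quat
twoPlusTwoI = quat (+ 2) (+ 2) 0ℤ 0ℤ

twoPlusTwoI∈Q² : ∀ b → InQ² 1 b twoPlusTwoI
twoPlusTwoI∈Q² b =
  subst (InQ² 1 b)
    (cong₂ qadd (qsq-gaussian 1 b 1ℤ 1ℤ) (cong₂ qadd (qsq-gaussian 1 b 1ℤ 0ℤ) (qsq-gaussian 1 b 1ℤ 0ℤ)))
    (plus (sq (quat 1ℤ 1ℤ 0ℤ 0ℤ)) (plus (sq (quat 1ℤ 0ℤ 0ℤ 0ℤ)) (sq (quat 1ℤ 0ℤ 0ℤ 0ℤ))))

twoPlusTwoI-not-sum-of-two-squares : ∀ b x y → qadd (qsq 1 b x) (qsq 1 b y) ≢ twoPlusTwoI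
twoPlusTwoI-not-sum-of-two-squares b x@(quat x0 x1 x2 x3) y@(quat y0 y1 y2 y3) eq =
  two-squares-system-unsolvable b x0 x1 x2 x3 y0 y1 y2 y3
    (halve (x0 * x1) (y0 * y1) 1ℤ (cong c1 expanded))
    (halve (x0 * x2) (y0 * y2) 0ℤ (cong c2 expanded))
    (halve (x0 * x3) (y0 * y3) 0ℤ (cong c3 expanded))
    (trans (sym (real-part (+ b) x0 x1 x2 x3 y0 y1 y2 y3)) (cong c0 expanded))
  where
  expanded : qadd (qsqExpanded 1 b x) (qsqExpanded 1 b y) ≡ twoPlusTwoI
  expanded = trans (sym (cong₂ qadd (qsq≡qsqExpanded 1 b x) (qsq≡qsqExpanded 1 b y))) eq
  halve : ∀ r s n → + 2 * r + + 2 * s ≡ + 2 * n → r + s ≡ n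
  halve r s n eq = ℤ.*-cancelˡ-≡ (+ 2) (r + s) n (trans (ℤ.*-distribˡ-+ (+ 2) r s) eq)
  real-part : ∀ B x0 x1 x2 x3 y0 y1 y2 y3 →
    (x0 * x0 - 1ℤ * (x1 * x1) - B * (x2 * x2) - 1ℤ * B * (x3 * x3)) +
    (y0 * y0 - 1ℤ * (y1 * y1) - B * (y2 * y2) - 1ℤ * B * (y3 * y3)) ≡
    (x0 * x0 + y0 * y0) - (x1 * x1 + y1 * y1) - B * ((x2 * x2 + y2 * y2) + (x3 * x3 + y3 * y3))
  real-part = solve-∀

twoPlusTwoI-needs-three-squares : ∀ b → ¬ SumOfAtMostSquares 1 b 2 twoPlusTwoI
twoPlusTwoI-needs-three-squares b ([] , _ , ())
twoPlusTwoI-needs-three-squares b (x ∷ [] , _ , eq) =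
  twoPlusTwoI-not-sum-of-two-squares b x qzero (trans (cong (qadd (qsq 1 b x)) (qsq-zero 1 b)) eq)
twoPlusTwoI-needs-three-squares b (x ∷ y ∷ [] , _ , eq) =
  twoPlusTwoI-not-sum-of-two-squares b x y (trans (sym (sumSq-pair 1 b x y)) eq)
twoPlusTwoI-needs-three-squares b (_ ∷ _ ∷ _ ∷ _ , s≤s (s≤s ()) , _)

sumOfAtMostSquares-mono : ∀ {a b g h y} → g ≤ h → SumOfAtMostSquares a b g y → SumOfAtMostSquares a b h y
sumOfAtMostSquares-mono g≤h (xs , length≤g , eq) = xs , ℕ.≤-trans length≤g g≤h , eq

three≤bound : ∀ b h → Bound 1 b h → 3 ≤ h
three≤bound b h bound with 3 ℕ.≤? h
... | yes 3≤h = 3≤h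
... | no 3≰h = ⊥-elim (twoPlusTwoI-needs-three-squares b
  (sumOfAtMostSquares-mono {a = 1} {b = b} (ℕ.≤-pred (ℕ.≰⇒> 3≰h)) (bound twoPlusTwoI (twoPlusTwoI∈Q² b))))

mainTheorem4 : ∀ (b : ℕ) → 1 ≤ b → Bound 1 b 3 × IsG2 1 b 3
mainTheorem4 b _ = bound-three b , s≤s z≤n , bound-three b , λ h _ → three≤bound b h
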